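{- Let $\lambda\in\mathbf{k}$. The species $\mathrm{ADF}$, with multiplication $m_{X,Y}:\mathrm{ADF}[X]\otimes\mathrm{ADF}[Y]\to\mathrm{ADF}[X\sqcup Y]$, $m_{X,Y}(F\otimes G)=F\diamond G$, and unit $\bullet\in\mathrm{ADF}[\emptyset]$, is a twisted algebra.
   Context: $\mathbf{k}$ is a field of characteristic zero. A species is a functor from the category of finite sets with bijections to $\mathbf{k}$-vector spaces. A twisted algebra is a species $P$ with linear maps $m_{X,Y}:P[X]\otimes P[Y]\to P[X\sqcup Y]$ for all disjoint finite sets $X,Y$ such that: $m_{X',Y'}\circ(P[\sigma]\otimes P[\tau])=P[\sigma\sqcup\tau]\circ m_{X,Y}$ for bijections $\sigma:X\to X'$, $\tau:Y\to Y'$; $m_{X\sqcup Y,Z}\circ(m_{X,Y}\otimes\mathrm{id})=m_{X,Y\sqcup Z}\circ(\mathrm{id}\otimes m_{Y,Z})$; and there is $1_P\in P[\emptyset]$ with $m_{\emptyset,X}(1_P\otimes u)=u=m_{X,\emptyset}(u\otimes 1_P)$ for all $u\in P[X]$. Angularly decorated forests: a planar rooted forest $T_1\cdots T_n$ with $\ell$ leaves has $\ell-1$ angles (gaps between consecutive leaves left to right, either inside a tree or between adjacent trees), written $T_1x_1T_2\cdots x_{n-1}T_n$ with $x_i$ decorating the gap between $T_i$ and $T_{i+1}$; $\bullet$ is the one-vertex tree. For a finite set $X$, $\mathrm{ADF}[X]$ is the vector space with basis the forests with exactly $|X|$ angles decorated bijectively by $X$; for a bijection $\sigma:X\to X'$,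 $\mathrm{ADF}[\sigma]$ replaces each decoration $x$ by $\sigma(x)$. $B^+$ adds a new root joined to the roots of all trees, keeping decorations; every tree other than $\bullet$ is $B^+$ of a unique forest. Depth of a tree = maximal root-to-leaf path length; depth of a forest = max over its trees. The product $\diamond$ of weight $\lambda$ is defined bilinearly by induction on the sum of depths: for trees, $\bullet\diamond\bullet=\bullet$, $T\diamond\bullet=T$, $\bullet\diamond T'=T'$, $B^+(A)\diamond B^+(A')=B^+(B^+(A)\diamond A')+B^+(A\diamond B^+(A'))+\lambda B^+(A\diamond A')$; for forests $F=T_1x_1\cdots x_mT_{m+1}$, $G=T'_1y_1\cdots y_nT'_{n+1}$, $F\diamond G=T_1x_1\cdots x_m(T_{m+1}\diamond T'_1)y_1T'_2\cdots y_nT'_{n+1}$. -}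

module Defs where

open import Level using (Level; _⊔_) renaming (suc to lsuc; zero to lzero)
open import Data.Nat using (ℕ; zero; suc)
open import Data.Product using (_×_; _,_; proj₁; proj₂; ∃)
open import Data.List using (List; []; _∷_; _++_; map; concatMap)
open import Data.List.Membership.Propositional using (_∈_)
open import Data.List.Relation.Unary.All using (All)
open import Data.List.Relation.Unary.Unique.Propositional using (Unique)
open import Data.List.Relation.Binary.Disjoint.Propositional using (Disjoint)
open import Data.List.Relation.Binary.Permutation.Propositional using (_↭_)
open import Relation.Binary.Definitions using (DecidableEquality)
open import Relation.Binary.PropositionalEquality using (_≡_; refl; cong; cong₂)
open import Relation.Nullary using (¬_; yes; no)
open import Algebra.Bundles using (CommutativeRing)

record Field (c ℓ : Level) : Set (lsuc (c ⊔ ℓ)) where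
  field
    commutativeRing : CommutativeRing c ℓ
  open CommutativeRing commutativeRing public
  field
    0≉1     : ¬ (0# ≈ 1#)
    inverse : ∀ x → ¬ (x ≈ 0#) → ∃ λ y → (x * y) ≈ 1#

module _ {c ℓ} (k : Field c ℓ) where
  open Field k

  natToField : ℕ → Carrier
  natToField zero    = 0#
  natToField (suc n) = 1# + natToField n

  CharacteristicZero : Set ℓ
  CharacteristicZero = ∀ n → ¬ (natToField (suc n) ≈ 0#)

-- Angularly decorated planar rooted trees / forests, decorations in D.
-- A forest T₁ x₁ T₂ ⋯ x_{n-1} Tₙ is  T₁ ∷⟨ x₁ ⟩ (T₂ ∷⟨ … ⟩ ⟦ Tₙ ⟧).
-- The angles of B⁺ F are exactly those of F.

mutual
  data DTree (D : Set) : Set where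
    •  : DTree D
    B⁺ : DForest D → DTree D

  data DForest (D : Set) : Set where
    ⟦_⟧    : DTree D → DForest D
    _∷⟨_⟩_ : DTree D → D → DForest D → DForest D

infixr 5 _∷⟨_⟩_

mutual
  decT : {D : Set} → DTree D → List D
  decT •      = []
  decT (B⁺ F) = decF F

  decF : {D : Set} → DForest D → List D
  decF ⟦ T ⟧         = decT T
  decF (T ∷⟨ x ⟩ F) = decT T ++ (x ∷ decF F)

mutual
  relT : {D E : Set} → (D → E) → DTree D → DTree E
  relT σ •      = •
  relT σ (B⁺ F) = B⁺ (relF σ F)

  relF : {D E : Set} → (D → E) → DForest D → DForest E
  relF σ ⟦ T ⟧         = ⟦ relT σ T ⟧
  relF σ (T ∷⟨ x ⟩ F) = relT σ T ∷⟨ σ x ⟩ relF σ F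

module _ {D : Set} (_≟_ : DecidableEquality D) where
  mutual
    decEqT : DecidableEquality (DTree D)
    decEqT • • = yes refl
    decEqT • (B⁺ _) = no (λ ())
    decEqT (B⁺ _) • = no (λ ())
    decEqT (B⁺ F) (B⁺ G) with decEqF F G
    ... | yes refl = yes refl
    ... | no ne = no (λ { refl → ne refl })

    decEqF : DecidableEquality (DForest D)
    decEqF ⟦ T ⟧ ⟦ S ⟧ with decEqT T S
    ... | yes refl = yes refl
    ... | no ne = no (λ { refl → ne refl })
    decEqF ⟦ _ ⟧ (_ ∷⟨ _ ⟩ _) = no (λ ())
    decEqF (_ ∷⟨ _ ⟩ _) ⟦ _ ⟧ = no (λ ())
    decEqF (T ∷⟨ x ⟩ F) (S ∷⟨ y ⟩ G) with decEqT T S | x ≟ y | decEqF F G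
    ... | yes refl | yes refl | yes refl = yes refl
    ... | no ne | _ | _ = no (λ { refl → ne refl })
    ... | yes _ | no ne | _ = no (λ { refl → ne refl })
    ... | yes _ | yes _ | no ne = no (λ { refl → ne refl })

-- All finite sets are taken to be finite subsets of an ambient set U
-- (with decidable equality), represented by duplicate-free lists; the
-- disjoint union of disjoint X, Y is X ++ Y.  Vectors of ADF are finite
-- formal k-linear combinations of decorated forests, compared
-- coefficientwise.

module ADF {c ℓ} (k : Field c ℓ) (λw : Field.Carrier k)
           (U : Set) (_≟_ : DecidableEquality U) where
  open Field k

  Lin : Set → Set c
  Lin B = List (Carrier × B)

  mapL : {B B' : Set} → (B → B') → Lin B → Lin B'
  mapL f = map (λ p → proj₁ p , f (proj₂ p))

  scale : {B : Set} → Carrier → Lin B → Lin B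
  scale a = map (λ p → a * proj₁ p , proj₂ p)

  Forest : Set
  Forest = DForest U

  coeff : Forest → Lin Forest → Carrier
  coeff F [] = 0#
  coeff F ((a , G) ∷ u) with decEqF _≟_ F G
  ... | yes _ = a + coeff F u
  ... | no _  = coeff F u

  _≋_ : Lin Forest → Lin Forest → Set ℓ
  u ≋ v = ∀ F → coeff F u ≈ coeff F v

  mutual
    tt : DTree U → DTree U → Lin (DTree U)
    tt • T'             = (1# , T') ∷ []
    tt (B⁺ A) •         = (1# , B⁺ A) ∷ []
    tt (B⁺ A) (B⁺ A')   =
         mapL B⁺ (tf (B⁺ A) A')
      ++ mapL B⁺ (ft A (B⁺ A'))
      ++ scale λw (mapL B⁺ (ff A A'))

    tf : DTree U → Forest → Lin Forest
    tf T ⟦ T' ⟧         = mapL ⟦_⟧ (tt T T')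
    tf T (T' ∷⟨ y ⟩ G) = mapL (λ S → S ∷⟨ y ⟩ G) (tt T T')

    ft : Forest → DTree U → Lin Forest
    ft ⟦ T ⟧ T'         = mapL ⟦_⟧ (tt T T')
    ft (T ∷⟨ x ⟩ F) T' = mapL (λ S → T ∷⟨ x ⟩ S) (ft F T')

    ff : Forest → Forest → Lin Forest
    ff ⟦ T ⟧ G         = tf T G
    ff (T ∷⟨ x ⟩ F) G = mapL (λ S → T ∷⟨ x ⟩ S) (ff F G)

  _⋄_ : Lin Forest → Lin Forest → Lin Forest
  u ⋄ v = concatMap (λ p → concatMap (λ q →
            scale (proj₁ p * proj₁ q) (ff (proj₂ p) (proj₂ q))) v) u

  -- u ∈ ADF[X]: u is a combination of forests whose angles are
  -- decorated bijectively by X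
  _∈ADF[_] : Lin Forest → List U → Set c
  u ∈ADF[ X ] = All (λ p → decF (proj₂ p) ↭ X) u

  relabel : (U → U) → Lin Forest → Lin Forest
  relabel σ = mapL (relF σ)

  unit : Lin Forest
  unit = (1# , ⟦ • ⟧) ∷ []

-- Twisted algebra structure on a species P whose finite sets are finite
-- subsets of U (duplicate-free lists).  Vectors of all P[X] live in a
-- common carrier V with equality _≈_ and membership u ∈P[ X ];
-- P[ σ ] for a bijection σ : X → X' is given by any σ : U → U with
-- map σ X ↭ X'.  The product m is bilinear by construction; tensor
-- identities are stated on pairs / triples of vectors.

record IsTwistedAlgebra {a ℓ₁ ℓ₂} (U : Set) {V : Set a}
       (_≈_ : V → V → Set ℓ₁) (_∈P[_] : V → List U → Set ℓ₂)
       (P[_] : (U → U) → V → V) (m : V → V → V) (1P : V)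
       : Set (a ⊔ ℓ₁ ⊔ ℓ₂) where
  field
    P-closed : ∀ {X X'} (σ : U → U) → Unique X → Unique X' →
               map σ X ↭ X' → ∀ {u} → u ∈P[ X ] → P[ σ ] u ∈P[ X' ]
    m-closed : ∀ {X Y} → Unique X → Unique Y → Disjoint X Y →
               ∀ {u v} → u ∈P[ X ] → v ∈P[ Y ] → m u v ∈P[ X ++ Y ]
    m-cong   : ∀ {u u' v v'} → u ≈ u' → v ≈ v' → m u v ≈ m u' v'
    natural  : ∀ {X Y X' Y'} (σ τ ρ : U → U) →
               Unique X → Unique Y → Unique X' → Unique Y' →
               Disjoint X Y → Disjoint X' Y' →
               map σ X ↭ X' → map τ Y ↭ Y' →
               (∀ {x} → x ∈ X → ρ x ≡ σ x) →
               (∀ {y} → y ∈ Y → ρ y ≡ τ y) →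
               ∀ {u v} → u ∈P[ X ] → v ∈P[ Y ] →
               m (P[ σ ] u) (P[ τ ] v) ≈ P[ ρ ] (m u v)
    assoc    : ∀ {X Y Z} → Unique X → Unique Y → Unique Z →
               Disjoint X Y → Disjoint X Z → Disjoint Y Z →
               ∀ {u v w} → u ∈P[ X ] → v ∈P[ Y ] → w ∈P[ Z ] →
               m (m u v) w ≈ m u (m v w)
    unit-in  : 1P ∈P[ [] ]
    unitˡ    : ∀ {X} → Unique X → ∀ {u} → u ∈P[ X ] → m 1P u ≈ u
    unitʳ    : ∀ {X} → Unique X → ∀ {u} → u ∈P[ X ] → m u 1P ≈ u

{-# OPTIONS --safe #-}
module Submission where

-- A formal combination u is probed by its pairings ⟪ u ∣ ψ ⟫ = Σ aᵢ ψ(Fᵢ) with functionals ψ on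
-- forests: two combinations have the same coefficients iff all their pairings agree, and the
-- pairing of a bilinear extension is an iterated pairing.  Congruence, unit laws and
-- associativity of ⋄ thus reduce to identities between pairings of products of basis forests.
-- Associativity on basis forests is proved by induction on the total number of vertices: a
-- product of forests only involves the last tree of the left factor and the first tree of the
-- right one, and for trees B⁺a, B⁺b, B⁺c the recursive definition expands both bracketings into
-- the same weighted sum of seven products of strictly smaller triples.  Relabelling commutes
-- with ⋄ on the nose and ⋄ concatenates angle words, which gives naturality and the grading.

open import Algebra.Bundles using (CommutativeRing)
open import Data.Bool using (if_then_else_)
open import Data.List using (List; []; _∷_; _++_; map; concatMap; filter; length)
import Data.List.Properties as List
open import Data.List.Membership.Propositional using (_∈_)
open import Data.List.Membership.Propositional.Properties using (∈-++⁺ˡ; ∈-++⁺ʳ)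
open import Data.List.Relation.Binary.Permutation.Propositional using (_↭_; ↭-refl; ↭-trans)
import Data.List.Relation.Binary.Permutation.Propositional.Properties as Perm
open import Data.List.Relation.Unary.All as AllU using (All; []; _∷_)
import Data.List.Relation.Unary.All.Properties as All
open import Data.List.Relation.Unary.Any using (here; there)
open import Data.Maybe using (nothing)
open import Data.Nat using (ℕ; suc; _≤_; _<_; s≤s)
import Data.Nat.Properties as ℕₚ
open import Data.Product using (_×_; _,_; proj₁; proj₂; map₁; map₂)
open import Function using (_∘_)
open import Level using (_⊔_)
open import Relation.Binary.Definitions using (DecidableEquality)
open import Relation.Binary.PropositionalEquality as ≡ using (_≡_; _≗_; module ≡-Reasoning)
open import Relation.Nullary using (Dec; does; yes; no; ¬_; ¬?)
open import Tactic.RingSolver using (solve-∀)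
open import Tactic.RingSolver.Core.AlmostCommutativeRing
  using (AlmostCommutativeRing; fromCommutativeRing)

open import Defs

map-commute : ∀ {a b b′ c} {A : Set a} {B : Set b} {B′ : Set b′} {C : Set c}
                {f : B → C} {g : A → B} {f′ : B′ → C} {g′ : A → B′} {xs ys} →
              f ∘ g ≗ f′ ∘ g′ → xs ≡ map g ys → map f xs ≡ map f′ (map g′ ys)
map-commute {f = f} {g} {f′} {g′} {ys = ys} fg≗f′g′ ≡.refl = begin
  map f (map g ys)    ≡⟨ List.map-∘ ys ⟨
  map (f ∘ g) ys      ≡⟨ List.map-cong fg≗f′g′ ys ⟩
  map (f′ ∘ g′) ys    ≡⟨ List.map-∘ ys ⟩
  map f′ (map g′ ys)  ∎
  where open ≡-Reasoning

module LinearCombination {c ℓ} (R : CommutativeRing c ℓ) where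
  open CommutativeRing R
  open import Relation.Binary.Reasoning.Setoid setoid
  open import Algebra.Properties.CommutativeSemigroup +-commutativeSemigroup
    using (interchange) renaming (x∙yz≈y∙xz to x∙yz≈y∙xz⁺)
  open import Algebra.Properties.CommutativeSemigroup *-commutativeSemigroup using (x∙yz≈y∙xz)
  open import Algebra.Properties.Group +-group using (x∙y⁻¹≈ε⇒x≈y)
  open import Algebra.Properties.Ring ring using (-1*x≈-x)

  private
    Lin : Set → Set c
    Lin B = List (Carrier × B)

    variable
      B C : Set

  scaleBy : Carrier → Lin B → Lin B
  scaleBy a = map (map₁ (a *_))

  ⟪_∣_⟫ : Lin B → (B → Carrier) → Carrier
  ⟪ [] ∣ ψ ⟫           = 0#
  ⟪ (a , b) ∷ u ∣ ψ ⟫ = a * ψ b + ⟪ u ∣ ψ ⟫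

  infix 4 _≐_
  _≐_ : Lin B → Lin B → Set (c ⊔ ℓ)
  u ≐ v = ∀ ψ → ⟪ u ∣ ψ ⟫ ≈ ⟪ v ∣ ψ ⟫

  ⟪⟫-++ : ∀ (u v : Lin B) ψ → ⟪ u ++ v ∣ ψ ⟫ ≈ ⟪ u ∣ ψ ⟫ + ⟪ v ∣ ψ ⟫
  ⟪⟫-++ []            v ψ = sym (+-identityˡ _)
  ⟪⟫-++ ((a , b) ∷ u) v ψ = trans (+-congˡ (⟪⟫-++ u v ψ)) (sym (+-assoc _ _ _))

  ⟪⟫-scaleBy : ∀ d (u : Lin B) ψ → ⟪ scaleBy d u ∣ ψ ⟫ ≈ d * ⟪ u ∣ ψ ⟫
  ⟪⟫-scaleBy d []            ψ = sym (zeroʳ d)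
  ⟪⟫-scaleBy d ((a , b) ∷ u) ψ = begin
    d * a * ψ b + ⟪ scaleBy d u ∣ ψ ⟫   ≈⟨ +-cong (*-assoc d a (ψ b)) (⟪⟫-scaleBy d u ψ) ⟩
    d * (a * ψ b) + d * ⟪ u ∣ ψ ⟫       ≈⟨ distribˡ d _ _ ⟨
    d * (a * ψ b + ⟪ u ∣ ψ ⟫)           ∎

  ⟪⟫-map : ∀ (f : B → C) (u : Lin B) ψ → ⟪ map (map₂ f) u ∣ ψ ⟫ ≈ ⟪ u ∣ ψ ∘ f ⟫
  ⟪⟫-map f []            ψ = refl
  ⟪⟫-map f ((a , b) ∷ u) ψ = +-congˡ (⟪⟫-map f u ψ)

  ⟪⟫-congʳ : ∀ (u : Lin B) {ψ χ} → (∀ b → ψ b ≈ χ b) → ⟪ u ∣ ψ ⟫ ≈ ⟪ u ∣ χ ⟫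
  ⟪⟫-congʳ []            eq = refl
  ⟪⟫-congʳ ((a , b) ∷ u) eq = +-cong (*-congˡ (eq b)) (⟪⟫-congʳ u eq)

  ⟪⟫-zeroʳ : ∀ (u : Lin B) → ⟪ u ∣ (λ _ → 0#) ⟫ ≈ 0#
  ⟪⟫-zeroʳ []            = refl
  ⟪⟫-zeroʳ ((a , b) ∷ u) = trans (+-cong (zeroʳ a) (⟪⟫-zeroʳ u)) (+-identityˡ 0#)

  ⟪⟫-+ʳ : ∀ (u : Lin B) ψ χ → ⟪ u ∣ (λ b → ψ b + χ b) ⟫ ≈ ⟪ u ∣ ψ ⟫ + ⟪ u ∣ χ ⟫
  ⟪⟫-+ʳ []            ψ χ = sym (+-identityˡ 0#)
  ⟪⟫-+ʳ ((a , b) ∷ u) ψ χ = begin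
    a * (ψ b + χ b) + ⟪ u ∣ (λ b → ψ b + χ b) ⟫       ≈⟨ +-cong (distribˡ a _ _) (⟪⟫-+ʳ u ψ χ) ⟩
    (a * ψ b + a * χ b) + (⟪ u ∣ ψ ⟫ + ⟪ u ∣ χ ⟫)    ≈⟨ interchange _ _ _ _ ⟩
    (a * ψ b + ⟪ u ∣ ψ ⟫) + (a * χ b + ⟪ u ∣ χ ⟫)    ∎

  ⟪⟫-*ʳ : ∀ (u : Lin B) d ψ → ⟪ u ∣ (λ b → d * ψ b) ⟫ ≈ d * ⟪ u ∣ ψ ⟫
  ⟪⟫-*ʳ []            d ψ = sym (zeroʳ d)
  ⟪⟫-*ʳ ((a , b) ∷ u) d ψ = begin
    a * (d * ψ b) + ⟪ u ∣ (λ b → d * ψ b) ⟫   ≈⟨ +-cong (x∙yz≈y∙xz a d (ψ b)) (⟪⟫-*ʳ u d ψ) ⟩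
    d * (a * ψ b) + d * ⟪ u ∣ ψ ⟫             ≈⟨ distribˡ d _ _ ⟨
    d * (a * ψ b + ⟪ u ∣ ψ ⟫)                 ∎

  ⟪⟫-swap : ∀ (u : Lin B) (v : Lin C) (χ : B → C → Carrier) →
            ⟪ u ∣ (λ b → ⟪ v ∣ χ b ⟫) ⟫ ≈ ⟪ v ∣ (λ c → ⟪ u ∣ (λ b → χ b c) ⟫) ⟫
  ⟪⟫-swap []            v χ = sym (⟪⟫-zeroʳ v)
  ⟪⟫-swap ((a , b) ∷ u) v χ = begin
    a * ⟪ v ∣ χ b ⟫ + ⟪ u ∣ (λ b → ⟪ v ∣ χ b ⟫) ⟫
      ≈⟨ +-cong (sym (⟪⟫-*ʳ v a (χ b))) (⟪⟫-swap u v χ) ⟩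
    ⟪ v ∣ (λ c → a * χ b c) ⟫ + ⟪ v ∣ (λ c → ⟪ u ∣ (λ b → χ b c) ⟫) ⟫
      ≈⟨ ⟪⟫-+ʳ v _ _ ⟨
    ⟪ v ∣ (λ c → a * χ b c + ⟪ u ∣ (λ b → χ b c) ⟫) ⟫
      ∎

  _⊖_ : Lin B → Lin B → Lin B
  u ⊖ v = u ++ scaleBy (- 1#) v

  ⟪⟫-⊖ : ∀ (u v : Lin B) ψ → ⟪ u ⊖ v ∣ ψ ⟫ ≈ ⟪ u ∣ ψ ⟫ - ⟪ v ∣ ψ ⟫
  ⟪⟫-⊖ u v ψ = begin
    ⟪ u ⊖ v ∣ ψ ⟫                         ≈⟨ ⟪⟫-++ u _ ψ ⟩
    ⟪ u ∣ ψ ⟫ + ⟪ scaleBy (- 1#) v ∣ ψ ⟫  ≈⟨ +-congˡ (⟪⟫-scaleBy (- 1#) v ψ) ⟩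
    ⟪ u ∣ ψ ⟫ + - 1# * ⟪ v ∣ ψ ⟫          ≈⟨ +-congˡ (-1*x≈-x _) ⟩
    ⟪ u ∣ ψ ⟫ - ⟪ v ∣ ψ ⟫                 ∎

  ⟪⟫-unit : ∀ (b : B) ψ → ⟪ (1# , b) ∷ [] ∣ ψ ⟫ ≈ ψ b
  ⟪⟫-unit b ψ = trans (+-identityʳ _) (*-identityˡ (ψ b))

  ⟪⟫-unit-≡ : ∀ {u : Lin B} {b} → u ≡ (1# , b) ∷ [] → ∀ ψ → ⟪ u ∣ ψ ⟫ ≈ ψ b
  ⟪⟫-unit-≡ {b = b} ≡.refl = ⟪⟫-unit b

  module KroneckerDelta {B : Set} (_≟_ : DecidableEquality B) where

    δ : B → B → Carrier
    δ b b′ = if does (b ≟ b′) then 1# else 0#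

    other? : ∀ b (p : Carrier × B) → Dec (¬ b ≡ proj₂ p)
    other? b p = ¬? (b ≟ proj₂ p)

    without : B → Lin B → Lin B
    without b = filter (other? b)

    ⟪⟫-split : ∀ b (u : Lin B) ψ → ⟪ u ∣ ψ ⟫ ≈ ⟪ u ∣ δ b ⟫ * ψ b + ⟪ without b u ∣ ψ ⟫
    ⟪⟫-split b []             ψ = sym (trans (+-identityʳ _) (zeroˡ (ψ b)))
    ⟪⟫-split b ((a , b′) ∷ u) ψ with b ≟ b′
    ... | yes ≡.refl = begin
      a * ψ b + ⟪ u ∣ ψ ⟫
        ≈⟨ +-congˡ (⟪⟫-split b u ψ) ⟩
      a * ψ b + (⟪ u ∣ δ b ⟫ * ψ b + ⟪ without b u ∣ ψ ⟫)
        ≈⟨ +-assoc _ _ _ ⟨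
      (a * ψ b + ⟪ u ∣ δ b ⟫ * ψ b) + ⟪ without b u ∣ ψ ⟫
        ≈⟨ +-congʳ (distribʳ (ψ b) a _) ⟨
      (a + ⟪ u ∣ δ b ⟫) * ψ b + ⟪ without b u ∣ ψ ⟫
        ≈⟨ +-congʳ (*-congʳ (+-congʳ (*-identityʳ a))) ⟨
      (a * 1# + ⟪ u ∣ δ b ⟫) * ψ b + ⟪ without b u ∣ ψ ⟫
        ∎
    ... | no _ = begin
      a * ψ b′ + ⟪ u ∣ ψ ⟫
        ≈⟨ +-congˡ (⟪⟫-split b u ψ) ⟩
      a * ψ b′ + (⟪ u ∣ δ b ⟫ * ψ b + ⟪ without b u ∣ ψ ⟫)
        ≈⟨ x∙yz≈y∙xz⁺ _ _ _ ⟩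
      ⟪ u ∣ δ b ⟫ * ψ b + (a * ψ b′ + ⟪ without b u ∣ ψ ⟫)
        ≈⟨ +-congʳ (*-congʳ (trans (+-congʳ (zeroʳ a)) (+-identityˡ _))) ⟨
      (a * 0# + ⟪ u ∣ δ b ⟫) * ψ b + (a * ψ b′ + ⟪ without b u ∣ ψ ⟫)
        ∎

    ⟪⟫-without : ∀ (u : Lin B) → (∀ b → ⟪ u ∣ δ b ⟫ ≈ 0#) → ∀ b → u ≐ without b u
    ⟪⟫-without u vanish b ψ = begin
      ⟪ u ∣ ψ ⟫                                  ≈⟨ ⟪⟫-split b u ψ ⟩
      ⟪ u ∣ δ b ⟫ * ψ b + ⟪ without b u ∣ ψ ⟫    ≈⟨ +-congʳ (trans (*-congʳ (vanish b)) (zeroˡ (ψ b))) ⟩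
      0# + ⟪ without b u ∣ ψ ⟫                   ≈⟨ +-identityˡ _ ⟩
      ⟪ without b u ∣ ψ ⟫                        ∎

    ⟪⟫-vanishes : ∀ (u : Lin B) → (∀ b → ⟪ u ∣ δ b ⟫ ≈ 0#) → u ≐ []
    ⟪⟫-vanishes u = bounded (length u) u ℕₚ.≤-refl
      where
      bounded : ∀ n (u : Lin B) → length u ≤ n → (∀ b → ⟪ u ∣ δ b ⟫ ≈ 0#) → u ≐ []
      bounded _       []            _         _      ψ = refl
      bounded (suc n) ((a , b) ∷ u) (s≤s len) vanish ψ = begin
        ⟪ (a , b) ∷ u ∣ ψ ⟫            ≈⟨ ⟪⟫-without ((a , b) ∷ u) vanish b ψ ⟩
        ⟪ without b ((a , b) ∷ u) ∣ ψ ⟫ ≈⟨ bounded n (without b ((a , b) ∷ u)) shorter vanish′ ψ ⟩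
        0#                             ∎
        where
        shorter : length (without b ((a , b) ∷ u)) ≤ n
        shorter = ℕₚ.≤-trans
          (ℕₚ.≤-reflexive (≡.cong length (List.filter-reject (other? b) λ b≢b → b≢b ≡.refl)))
          (ℕₚ.≤-trans (List.length-filter (other? b) u) len)
        vanish′ : ∀ b′ → ⟪ without b ((a , b) ∷ u) ∣ δ b′ ⟫ ≈ 0#
        vanish′ b′ = trans (sym (⟪⟫-without ((a , b) ∷ u) vanish b (δ b′))) (vanish b′)

    ⟪⟫-determined-by-δ : ∀ (u v : Lin B) → (∀ b → ⟪ u ∣ δ b ⟫ ≈ ⟪ v ∣ δ b ⟫) → u ≐ v
    ⟪⟫-determined-by-δ u v eq ψ =
      x∙y⁻¹≈ε⇒x≈y _ _ (trans (sym (⟪⟫-⊖ u v ψ)) (⟪⟫-vanishes (u ⊖ v) vanish ψ))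
      where
      vanish : ∀ b → ⟪ u ⊖ v ∣ δ b ⟫ ≈ 0#
      vanish b = trans (⟪⟫-⊖ u v (δ b)) (trans (+-congʳ (eq b)) (-‿inverseʳ _))

  AssociativeAt : (B → B → Lin B) → B → B → B → Set (c ⊔ ℓ)
  AssociativeAt μ x y z =
    ∀ ψ → ⟪ μ x y ∣ (λ s → ⟪ μ s z ∣ ψ ⟫) ⟫ ≈ ⟪ μ y z ∣ (λ t → ⟪ μ x t ∣ ψ ⟫) ⟫

  module _ (μ : B → B → Lin B) (e : B) where

    AssociativeAt-identityˡ : (∀ y → μ e y ≡ (1# , y) ∷ []) → ∀ y z → AssociativeAt μ e y z
    AssociativeAt-identityˡ identityˡ y z ψ = begin
      ⟪ μ e y ∣ (λ s → ⟪ μ s z ∣ ψ ⟫) ⟫   ≈⟨ ⟪⟫-unit-≡ (identityˡ y) _ ⟩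
      ⟪ μ y z ∣ ψ ⟫                       ≈⟨ ⟪⟫-congʳ (μ y z) (λ t → ⟪⟫-unit-≡ (identityˡ t) ψ) ⟨
      ⟪ μ y z ∣ (λ t → ⟪ μ e t ∣ ψ ⟫) ⟫   ∎

    AssociativeAt-identityᵐ : (∀ y → μ e y ≡ (1# , y) ∷ []) → (∀ x → μ x e ≡ (1# , x) ∷ []) →
                              ∀ x z → AssociativeAt μ x e z
    AssociativeAt-identityᵐ identityˡ identityʳ x z ψ = begin
      ⟪ μ x e ∣ (λ s → ⟪ μ s z ∣ ψ ⟫) ⟫   ≈⟨ ⟪⟫-unit-≡ (identityʳ x) _ ⟩
      ⟪ μ x z ∣ ψ ⟫                       ≈⟨ ⟪⟫-unit-≡ (identityˡ z) _ ⟨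
      ⟪ μ e z ∣ (λ t → ⟪ μ x t ∣ ψ ⟫) ⟫   ∎

    AssociativeAt-identityʳ : (∀ x → μ x e ≡ (1# , x) ∷ []) → ∀ x y → AssociativeAt μ x y e
    AssociativeAt-identityʳ identityʳ x y ψ = begin
      ⟪ μ x y ∣ (λ s → ⟪ μ s e ∣ ψ ⟫) ⟫   ≈⟨ ⟪⟫-congʳ (μ x y) (λ s → ⟪⟫-unit-≡ (identityʳ s) ψ) ⟩
      ⟪ μ x y ∣ ψ ⟫                       ≈⟨ ⟪⟫-unit-≡ (identityʳ y) _ ⟨
      ⟪ μ y e ∣ (λ t → ⟪ μ x t ∣ ψ ⟫) ⟫   ∎

  module Bilinear {B : Set} (μ : B → B → Lin B) where

    infixl 7 _⋆_
    _⋆₁_ : Carrier × B → Lin B → Lin B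
    (a , x) ⋆₁ v = concatMap (λ q → scaleBy (a * proj₁ q) (μ x (proj₂ q))) v

    _⋆_ : Lin B → Lin B → Lin B
    u ⋆ v = concatMap (_⋆₁ v) u

    ⟪⋆₁⟫ : ∀ a x (v : Lin B) ψ → ⟪ (a , x) ⋆₁ v ∣ ψ ⟫ ≈ a * ⟪ v ∣ (λ y → ⟪ μ x y ∣ ψ ⟫) ⟫
    ⟪⋆₁⟫ a x []            ψ = sym (zeroʳ a)
    ⟪⋆₁⟫ a x ((b , y) ∷ v) ψ = begin
      ⟪ scaleBy (a * b) (μ x y) ++ (a , x) ⋆₁ v ∣ ψ ⟫
        ≈⟨ ⟪⟫-++ (scaleBy (a * b) (μ x y)) _ ψ ⟩
      ⟪ scaleBy (a * b) (μ x y) ∣ ψ ⟫ + ⟪ (a , x) ⋆₁ v ∣ ψ ⟫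
        ≈⟨ +-cong (trans (⟪⟫-scaleBy (a * b) (μ x y) ψ) (*-assoc a b _)) (⟪⋆₁⟫ a x v ψ) ⟩
      a * (b * ⟪ μ x y ∣ ψ ⟫) + a * ⟪ v ∣ (λ y → ⟪ μ x y ∣ ψ ⟫) ⟫
        ≈⟨ distribˡ a _ _ ⟨
      a * ⟪ (b , y) ∷ v ∣ (λ y → ⟪ μ x y ∣ ψ ⟫) ⟫
        ∎

    ⟪⋆⟫ : ∀ (u v : Lin B) ψ → ⟪ u ⋆ v ∣ ψ ⟫ ≈ ⟪ u ∣ (λ x → ⟪ v ∣ (λ y → ⟪ μ x y ∣ ψ ⟫) ⟫) ⟫
    ⟪⋆⟫ []            v ψ = refl
    ⟪⋆⟫ ((a , x) ∷ u) v ψ =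
      trans (⟪⟫-++ ((a , x) ⋆₁ v) (u ⋆ v) ψ) (+-cong (⟪⋆₁⟫ a x v ψ) (⟪⋆⟫ u v ψ))

    ⋆-cong : ∀ {u u′ v v′ : Lin B} → u ≐ u′ → v ≐ v′ → u ⋆ v ≐ u′ ⋆ v′
    ⋆-cong {u} {u′} {v} {v′} u≐u′ v≐v′ ψ = begin
      ⟪ u ⋆ v ∣ ψ ⟫                                           ≈⟨ ⟪⋆⟫ u v ψ ⟩
      ⟪ u ∣ (λ x → ⟪ v ∣ (λ y → ⟪ μ x y ∣ ψ ⟫) ⟫) ⟫            ≈⟨ u≐u′ _ ⟩
      ⟪ u′ ∣ (λ x → ⟪ v ∣ (λ y → ⟪ μ x y ∣ ψ ⟫) ⟫) ⟫           ≈⟨ ⟪⟫-congʳ u′ (λ x → v≐v′ _) ⟩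
      ⟪ u′ ∣ (λ x → ⟪ v′ ∣ (λ y → ⟪ μ x y ∣ ψ ⟫) ⟫) ⟫          ≈⟨ ⟪⋆⟫ u′ v′ ψ ⟨
      ⟪ u′ ⋆ v′ ∣ ψ ⟫                                         ∎

    ⋆-assoc : (∀ x y z → AssociativeAt μ x y z) → ∀ (u v w : Lin B) → (u ⋆ v) ⋆ w ≐ u ⋆ (v ⋆ w)
    ⋆-assoc assoc u v w ψ = begin
      ⟪ (u ⋆ v) ⋆ w ∣ ψ ⟫
        ≈⟨ ⟪⋆⟫ (u ⋆ v) w ψ ⟩
      ⟪ u ⋆ v ∣ (λ s → ⟪ w ∣ (λ z → ⟪ μ s z ∣ ψ ⟫) ⟫) ⟫
        ≈⟨ ⟪⋆⟫ u v _ ⟩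
      ⟪ u ∣ (λ x → ⟪ v ∣ (λ y → ⟪ μ x y ∣ (λ s → ⟪ w ∣ (λ z → ⟪ μ s z ∣ ψ ⟫) ⟫) ⟫) ⟫) ⟫
        ≈⟨ ⟪⟫-congʳ u (λ x → ⟪⟫-congʳ v (λ y → ⟪⟫-swap (μ x y) w _)) ⟩
      ⟪ u ∣ (λ x → ⟪ v ∣ (λ y → ⟪ w ∣ (λ z → ⟪ μ x y ∣ (λ s → ⟪ μ s z ∣ ψ ⟫) ⟫) ⟫) ⟫) ⟫
        ≈⟨ ⟪⟫-congʳ u (λ x → ⟪⟫-congʳ v (λ y → ⟪⟫-congʳ w (λ z → assoc x y z ψ))) ⟩
      ⟪ u ∣ (λ x → ⟪ v ∣ (λ y → ⟪ w ∣ (λ z → ⟪ μ y z ∣ (λ t → ⟪ μ x t ∣ ψ ⟫) ⟫) ⟫) ⟫) ⟫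
        ≈⟨ ⟪⟫-congʳ u (λ x → ⟪⋆⟫ v w _) ⟨
      ⟪ u ∣ (λ x → ⟪ v ⋆ w ∣ (λ t → ⟪ μ x t ∣ ψ ⟫) ⟫) ⟫
        ≈⟨ ⟪⋆⟫ u (v ⋆ w) ψ ⟨
      ⟪ u ⋆ (v ⋆ w) ∣ ψ ⟫
        ∎

    ⋆-identityˡ : ∀ e → (∀ y → μ e y ≡ (1# , y) ∷ []) → ∀ (u : Lin B) → ((1# , e) ∷ []) ⋆ u ≐ u
    ⋆-identityˡ e identityˡ u ψ = begin
      ⟪ ((1# , e) ∷ []) ⋆ u ∣ ψ ⟫
        ≈⟨ ⟪⋆⟫ ((1# , e) ∷ []) u ψ ⟩
      ⟪ (1# , e) ∷ [] ∣ (λ x → ⟪ u ∣ (λ y → ⟪ μ x y ∣ ψ ⟫) ⟫) ⟫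
        ≈⟨ ⟪⟫-unit e (λ x → ⟪ u ∣ (λ y → ⟪ μ x y ∣ ψ ⟫) ⟫) ⟩
      ⟪ u ∣ (λ y → ⟪ μ e y ∣ ψ ⟫) ⟫
        ≈⟨ ⟪⟫-congʳ u (λ y → ⟪⟫-unit-≡ (identityˡ y) ψ) ⟩
      ⟪ u ∣ ψ ⟫
        ∎

    ⋆-identityʳ : ∀ e → (∀ x → μ x e ≡ (1# , x) ∷ []) → ∀ (u : Lin B) → u ⋆ ((1# , e) ∷ []) ≐ u
    ⋆-identityʳ e identityʳ u ψ = begin
      ⟪ u ⋆ ((1# , e) ∷ []) ∣ ψ ⟫
        ≈⟨ ⟪⋆⟫ u ((1# , e) ∷ []) ψ ⟩
      ⟪ u ∣ (λ x → ⟪ (1# , e) ∷ [] ∣ (λ y → ⟪ μ x y ∣ ψ ⟫) ⟫) ⟫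
        ≈⟨ ⟪⟫-congʳ u (λ x → ⟪⟫-unit e (λ y → ⟪ μ x y ∣ ψ ⟫)) ⟩
      ⟪ u ∣ (λ x → ⟪ μ x e ∣ ψ ⟫) ⟫
        ≈⟨ ⟪⟫-congʳ u (λ x → ⟪⟫-unit-≡ (identityʳ x) ψ) ⟩
      ⟪ u ∣ ψ ⟫
        ∎

    ⋆-map : ∀ (f : B → B) → (∀ x y → μ (f x) (f y) ≡ map (map₂ f) (μ x y)) →
            ∀ (u v : Lin B) → map (map₂ f) u ⋆ map (map₂ f) v ≡ map (map₂ f) (u ⋆ v)
    ⋆-map f equivariant []            v = ≡.refl
    ⋆-map f equivariant ((a , x) ∷ u) v =
      ≡.trans (≡.cong₂ _++_ (row v) (⋆-map f equivariant u v))
              (≡.sym (List.map-++ _ ((a , x) ⋆₁ v) (u ⋆ v)))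
      where
      row : ∀ v → (a , f x) ⋆₁ map (map₂ f) v ≡ map (map₂ f) ((a , x) ⋆₁ v)
      row []            = ≡.refl
      row ((b , y) ∷ v) =
        ≡.trans (≡.cong₂ _++_ (map-commute (λ _ → ≡.refl) (equivariant x y)) (row v))
                (≡.sym (List.map-++ _ (scaleBy (a * b) (μ x y)) ((a , x) ⋆₁ v)))

    ⋆-All : ∀ {r} {P Q R : B → Set r} → (∀ {x y} → P x → Q y → All (R ∘ proj₂) (μ x y)) →
            ∀ {u v} → All (P ∘ proj₂) u → All (Q ∘ proj₂) v → All (R ∘ proj₂) (u ⋆ v)
    ⋆-All {P = P} {R = R} closed {v = v} Pu Qv = All.concat⁺ (All.map⁺ (AllU.map row Pu))
      where
      row : ∀ {p} → P (proj₂ p) → All (R ∘ proj₂) (p ⋆₁ v)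
      row Px = All.concat⁺ (All.map⁺ (AllU.map (λ Qy → All.map⁺ (closed Px Qy)) Qv))

module _ {D : Set} where
  open Data.Nat using (_+_)

  mutual
    sizeT : DTree D → ℕ
    sizeT •      = 1
    sizeT (B⁺ F) = suc (sizeF F)

    sizeF : DForest D → ℕ
    sizeF ⟦ T ⟧        = sizeT T
    sizeF (T ∷⟨ _ ⟩ F) = sizeT T + sizeF F

  size³ : DForest D → DForest D → DForest D → ℕ
  size³ F G W = sizeF F + sizeF G + sizeF W

  unwrap₁ : ∀ F G W → size³ F G W < size³ ⟦ B⁺ F ⟧ G W
  unwrap₁ F G W = ℕₚ.n<1+n (size³ F G W)

  unwrap₂ : ∀ F G W → size³ F G W < size³ F ⟦ B⁺ G ⟧ W
  unwrap₂ F G W = ℕₚ.+-monoˡ-< (sizeF W) (ℕₚ.+-monoʳ-< (sizeF F) (ℕₚ.n<1+n (sizeF G)))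

  unwrap₃ : ∀ F G W → size³ F G W < size³ F G ⟦ B⁺ W ⟧
  unwrap₃ F G W = ℕₚ.+-monoʳ-< (sizeF F + sizeF G) (ℕₚ.n<1+n (sizeF W))

  size³-∷₁ : ∀ T x F G W → size³ F G W ≤ size³ (T ∷⟨ x ⟩ F) G W
  size³-∷₁ T x F G W =
    ℕₚ.+-monoˡ-≤ (sizeF W) (ℕₚ.+-monoˡ-≤ (sizeF G) (ℕₚ.m≤n+m (sizeF F) (sizeT T)))

  size³-∷₃ : ∀ F G T x W → size³ F G ⟦ T ⟧ ≤ size³ F G (T ∷⟨ x ⟩ W)
  size³-∷₃ F G T x W = ℕₚ.+-monoʳ-≤ (sizeF F + sizeF G) (ℕₚ.m≤m+n (sizeT T) (sizeF W))

module Regrouping {c ℓ} (R : CommutativeRing c ℓ) where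
  private
    ring : AlmostCommutativeRing c ℓ
    ring = fromCommutativeRing R (λ _ → nothing)
  open AlmostCommutativeRing ring

  regroupˡ : ∀ l x₁ y₁ z₁ x₂ y₂ z₂ x₃ y₃ z₃ →
    (x₁ + (y₁ + l * z₁)) + ((x₂ + (y₂ + l * z₂)) + l * (x₃ + (y₃ + l * z₃)))
    ≈ (x₁ + (x₂ + l * x₃)) + (y₁ + (y₂ + l * (y₃ + (z₁ + (z₂ + l * z₃)))))
  regroupˡ = solve-∀ ring

  regroupʳ : ∀ l x₁ y₁ z₁ x₂ y₂ z₂ x₃ y₃ z₃ →
    (x₁ + (y₁ + l * z₁)) + ((x₂ + (y₂ + l * z₂)) + l * (x₃ + (y₃ + l * z₃)))
    ≈ x₁ + (x₂ + ((y₁ + (y₂ + l * y₃)) + l * (z₂ + (x₃ + (z₁ + l * z₃)))))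
  regroupʳ = solve-∀ ring

module ADFProperties {c ℓ} (k : Field c ℓ) (λw : Field.Carrier k)
                     (U : Set) (_≟_ : DecidableEquality U) where
  open Field k
  open ADF k λw U _≟_
  open LinearCombination commutativeRing
  open KroneckerDelta (decEqF _≟_)
  -- _⋄_ is definitionally Bilinear._⋆_ ff.
  open Bilinear ff
  open Regrouping commutativeRing
  open import Relation.Binary.Reasoning.Setoid setoid

  coeff≈⟪δ⟫ : ∀ F u → coeff F u ≈ ⟪ u ∣ δ F ⟫
  coeff≈⟪δ⟫ F []            = refl
  coeff≈⟪δ⟫ F ((a , G) ∷ u) with decEqF _≟_ F G
  ... | yes _ = +-cong (sym (*-identityʳ a)) (coeff≈⟪δ⟫ F u)
  ... | no _  = trans (coeff≈⟪δ⟫ F u) (sym (trans (+-congʳ (zeroʳ a)) (+-identityˡ _)))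

  ≋⇒≐ : ∀ u v → u ≋ v → u ≐ v
  ≋⇒≐ u v u≋v = ⟪⟫-determined-by-δ u v λ F →
    trans (sym (coeff≈⟪δ⟫ F u)) (trans (u≋v F) (coeff≈⟪δ⟫ F v))

  ≐⇒≋ : ∀ u v → u ≐ v → u ≋ v
  ≐⇒≋ u v u≐v F = trans (coeff≈⟪δ⟫ F u) (trans (u≐v (δ F)) (sym (coeff≈⟪δ⟫ F v)))

  ⋄-cong : ∀ {u u′ v v′} → u ≋ u′ → v ≋ v′ → (u ⋄ v) ≋ (u′ ⋄ v′)
  ⋄-cong {u} {u′} {v} {v′} u≋u′ v≋v′ =
    ≐⇒≋ (u ⋄ v) (u′ ⋄ v′) (⋆-cong {u} {u′} {v} {v′} (≋⇒≐ u u′ u≋u′) (≋⇒≐ v v′ v≋v′))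

  Tree : Set
  Tree = DTree U

  ft≡ff : ∀ F T → ft F T ≡ ff F ⟦ T ⟧
  ft≡ff ⟦ _ ⟧        T = ≡.refl
  ft≡ff (S ∷⟨ x ⟩ F) T = ≡.cong (mapL (S ∷⟨ x ⟩_)) (ft≡ff F T)

  tt-identityʳ : ∀ T → tt T • ≡ (1# , T) ∷ []
  tt-identityʳ •      = ≡.refl
  tt-identityʳ (B⁺ _) = ≡.refl

  ff-identityˡ : ∀ G → ff ⟦ • ⟧ G ≡ (1# , G) ∷ []
  ff-identityˡ ⟦ _ ⟧       = ≡.refl
  ff-identityˡ (_ ∷⟨ _ ⟩ _) = ≡.refl

  ff-identityʳ : ∀ F → ff F ⟦ • ⟧ ≡ (1# , F) ∷ []
  ff-identityʳ ⟦ T ⟧        = ≡.cong (mapL ⟦_⟧) (tt-identityʳ T)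
  ff-identityʳ (T ∷⟨ x ⟩ F) = ≡.cong (mapL (T ∷⟨ x ⟩_)) (ff-identityʳ F)

  rotaBaxter : Carrier → Carrier → Carrier → Carrier
  rotaBaxter x y z = x + (y + λw * z)

  rotaBaxter-cong : ∀ {x x′ y y′ z z′} → x ≈ x′ → y ≈ y′ → z ≈ z′ →
                    rotaBaxter x y z ≈ rotaBaxter x′ y′ z′
  rotaBaxter-cong x≈x′ y≈y′ z≈z′ = +-cong x≈x′ (+-cong y≈y′ (*-congˡ z≈z′))

  ⟪⟫-rotaBaxter : ∀ {B} (u : List (Carrier × B)) f g h →
                  ⟪ u ∣ (λ b → rotaBaxter (f b) (g b) (h b)) ⟫
                  ≈ rotaBaxter ⟪ u ∣ f ⟫ ⟪ u ∣ g ⟫ ⟪ u ∣ h ⟫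
  ⟪⟫-rotaBaxter u f g h = begin
    ⟪ u ∣ (λ b → f b + (g b + λw * h b)) ⟫          ≈⟨ ⟪⟫-+ʳ u f _ ⟩
    ⟪ u ∣ f ⟫ + ⟪ u ∣ (λ b → g b + λw * h b) ⟫      ≈⟨ +-congˡ (⟪⟫-+ʳ u g _) ⟩
    ⟪ u ∣ f ⟫ + (⟪ u ∣ g ⟫ + ⟪ u ∣ (λ b → λw * h b) ⟫) ≈⟨ +-congˡ (+-congˡ (⟪⟫-*ʳ u λw h)) ⟩
    rotaBaxter ⟪ u ∣ f ⟫ ⟪ u ∣ g ⟫ ⟪ u ∣ h ⟫          ∎

  ⟪tt-B⁺⟫ : ∀ A A′ Φ → ⟪ tt (B⁺ A) (B⁺ A′) ∣ Φ ⟫ ≈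
            rotaBaxter ⟪ ff ⟦ B⁺ A ⟧ A′ ∣ Φ ∘ B⁺ ⟫ ⟪ ff A ⟦ B⁺ A′ ⟧ ∣ Φ ∘ B⁺ ⟫ ⟪ ff A A′ ∣ Φ ∘ B⁺ ⟫
  ⟪tt-B⁺⟫ A A′ Φ =
    trans (⟪⟫-++ (mapL B⁺ (ff ⟦ B⁺ A ⟧ A′)) _ Φ)
          (+-cong left (trans (⟪⟫-++ (mapL B⁺ (ft A (B⁺ A′))) _ Φ) (+-cong middle right)))
    where
    left : ⟪ mapL B⁺ (ff ⟦ B⁺ A ⟧ A′) ∣ Φ ⟫ ≈ ⟪ ff ⟦ B⁺ A ⟧ A′ ∣ Φ ∘ B⁺ ⟫
    left = ⟪⟫-map B⁺ (ff ⟦ B⁺ A ⟧ A′) Φ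

    middle : ⟪ mapL B⁺ (ft A (B⁺ A′)) ∣ Φ ⟫ ≈ ⟪ ff A ⟦ B⁺ A′ ⟧ ∣ Φ ∘ B⁺ ⟫
    middle = trans (reflexive (≡.cong (λ u → ⟪ mapL B⁺ u ∣ Φ ⟫) (ft≡ff A (B⁺ A′))))
                   (⟪⟫-map B⁺ (ff A ⟦ B⁺ A′ ⟧) Φ)

    right : ⟪ scale λw (mapL B⁺ (ff A A′)) ∣ Φ ⟫ ≈ λw * ⟪ ff A A′ ∣ Φ ∘ B⁺ ⟫
    right = trans (⟪⟫-scaleBy λw (mapL B⁺ (ff A A′)) Φ) (*-congˡ (⟪⟫-map B⁺ (ff A A′) Φ))

  leftAssociated rightAssociated : (Forest → Carrier) → Forest → Forest → Forest → Carrier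
  leftAssociated  ψ F G W = ⟪ ff F G ∣ (λ K → ⟪ ff K W ∣ ψ ⟫) ⟫
  rightAssociated ψ F G W = ⟪ ff G W ∣ (λ M → ⟪ ff F M ∣ ψ ⟫) ⟫

  module _ (a b c : Forest) where

    -- Σ over nonempty S ⊆ {1,2,3} of λ^(|S|-1) · t X₁ X₂ X₃, where Xᵢ is the i-th of a, b, c
    -- for i ∈ S and the corresponding one-tree forest ⟦ B⁺ _ ⟧ otherwise.
    expansion : (Forest → Forest → Forest → Carrier) → Carrier
    expansion t =
      t ⟦ B⁺ a ⟧ ⟦ B⁺ b ⟧ c + (t ⟦ B⁺ a ⟧ b ⟦ B⁺ c ⟧ + (t a ⟦ B⁺ b ⟧ ⟦ B⁺ c ⟧ +
      λw * (t a b ⟦ B⁺ c ⟧ + (t ⟦ B⁺ a ⟧ b c + (t a ⟦ B⁺ b ⟧ c + λw * t a b c)))))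

    expansion-cong : ∀ t t′ →
                     (∀ F G W → size³ F G W < size³ ⟦ B⁺ a ⟧ ⟦ B⁺ b ⟧ ⟦ B⁺ c ⟧ → t F G W ≈ t′ F G W) →
                     expansion t ≈ expansion t′
    expansion-cong t t′ eq =
      +-cong (eq ⟦ B⁺ a ⟧ ⟦ B⁺ b ⟧ c (unwrap₃ ⟦ B⁺ a ⟧ ⟦ B⁺ b ⟧ c))
     (+-cong (eq ⟦ B⁺ a ⟧ b ⟦ B⁺ c ⟧ (unwrap₂ ⟦ B⁺ a ⟧ b ⟦ B⁺ c ⟧))
     (+-cong (eq a ⟦ B⁺ b ⟧ ⟦ B⁺ c ⟧ (unwrap₁ a ⟦ B⁺ b ⟧ ⟦ B⁺ c ⟧))
     (*-congˡ (+-cong (eq a b ⟦ B⁺ c ⟧ abPc)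
      (+-cong (eq ⟦ B⁺ a ⟧ b c (<-trans (unwrap₃ ⟦ B⁺ a ⟧ b c) (unwrap₂ ⟦ B⁺ a ⟧ b ⟦ B⁺ c ⟧)))
      (+-cong (eq a ⟦ B⁺ b ⟧ c (<-trans (unwrap₃ a ⟦ B⁺ b ⟧ c) (unwrap₁ a ⟦ B⁺ b ⟧ ⟦ B⁺ c ⟧)))
      (*-congˡ (eq a b c (<-trans (unwrap₃ a b c) abPc)))))))))
      where
      open ℕₚ using (<-trans)
      abPc : size³ a b ⟦ B⁺ c ⟧ < size³ ⟦ B⁺ a ⟧ ⟦ B⁺ b ⟧ ⟦ B⁺ c ⟧
      abPc = <-trans (unwrap₂ a b ⟦ B⁺ c ⟧) (unwrap₁ a ⟦ B⁺ b ⟧ ⟦ B⁺ c ⟧)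

    expansionˡ : ∀ ψ → ⟪ tt (B⁺ a) (B⁺ b) ∣ (λ S → ⟪ tt S (B⁺ c) ∣ ψ ⟫) ⟫
                       ≈ expansion (leftAssociated (ψ ∘ B⁺))
    expansionˡ ψ =
      trans (⟪tt-B⁺⟫ a b (λ S → ⟪ tt S (B⁺ c) ∣ ψ ⟫))
     (trans (rotaBaxter-cong (expand (ff ⟦ B⁺ a ⟧ b)) (expand (ff a ⟦ B⁺ b ⟧)) (expand (ff a b)))
     (trans (regroupˡ λw _ _ _ _ _ _ _ _ _)
            (+-congʳ collapse)))
      where
      ψ′ : Forest → Carrier
      ψ′ = ψ ∘ B⁺
      expand : ∀ u → ⟪ u ∣ (λ K → ⟪ tt (B⁺ K) (B⁺ c) ∣ ψ ⟫) ⟫ ≈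
               rotaBaxter ⟪ u ∣ (λ K → ⟪ ff ⟦ B⁺ K ⟧ c ∣ ψ′ ⟫) ⟫ ⟪ u ∣ (λ K → ⟪ ff K ⟦ B⁺ c ⟧ ∣ ψ′ ⟫) ⟫
                          ⟪ u ∣ (λ K → ⟪ ff K c ∣ ψ′ ⟫) ⟫
      expand u = trans (⟪⟫-congʳ u (λ K → ⟪tt-B⁺⟫ K c ψ)) (⟪⟫-rotaBaxter u _ _ _)
      collapse : rotaBaxter ⟪ ff ⟦ B⁺ a ⟧ b ∣ (λ K → ⟪ ff ⟦ B⁺ K ⟧ c ∣ ψ′ ⟫) ⟫
                            ⟪ ff a ⟦ B⁺ b ⟧ ∣ (λ K → ⟪ ff ⟦ B⁺ K ⟧ c ∣ ψ′ ⟫) ⟫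
                            ⟪ ff a b ∣ (λ K → ⟪ ff ⟦ B⁺ K ⟧ c ∣ ψ′ ⟫) ⟫
                 ≈ leftAssociated ψ′ ⟦ B⁺ a ⟧ ⟦ B⁺ b ⟧ c
      collapse = trans (sym (⟪tt-B⁺⟫ a b (λ S → ⟪ ff ⟦ S ⟧ c ∣ ψ′ ⟫)))
                       (sym (⟪⟫-map ⟦_⟧ (tt (B⁺ a) (B⁺ b)) (λ K → ⟪ ff K c ∣ ψ′ ⟫)))

    expansionʳ : ∀ ψ → ⟪ tt (B⁺ b) (B⁺ c) ∣ (λ S → ⟪ tt (B⁺ a) S ∣ ψ ⟫) ⟫
                       ≈ expansion (rightAssociated (ψ ∘ B⁺))
    expansionʳ ψ =
      trans (⟪tt-B⁺⟫ b c (λ S → ⟪ tt (B⁺ a) S ∣ ψ ⟫))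
     (trans (rotaBaxter-cong (expand (ff ⟦ B⁺ b ⟧ c)) (expand (ff b ⟦ B⁺ c ⟧)) (expand (ff b c)))
     (trans (regroupʳ λw _ _ _ _ _ _ _ _ _)
            (+-congˡ (+-congˡ (+-congʳ collapse)))))
      where
      ψ′ : Forest → Carrier
      ψ′ = ψ ∘ B⁺
      expand : ∀ u → ⟪ u ∣ (λ M → ⟪ tt (B⁺ a) (B⁺ M) ∣ ψ ⟫) ⟫ ≈
               rotaBaxter ⟪ u ∣ (λ M → ⟪ ff ⟦ B⁺ a ⟧ M ∣ ψ′ ⟫) ⟫ ⟪ u ∣ (λ M → ⟪ ff a ⟦ B⁺ M ⟧ ∣ ψ′ ⟫) ⟫
                          ⟪ u ∣ (λ M → ⟪ ff a M ∣ ψ′ ⟫) ⟫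
      expand u = trans (⟪⟫-congʳ u (λ M → ⟪tt-B⁺⟫ a M ψ)) (⟪⟫-rotaBaxter u _ _ _)
      collapse : rotaBaxter ⟪ ff ⟦ B⁺ b ⟧ c ∣ (λ M → ⟪ ff a ⟦ B⁺ M ⟧ ∣ ψ′ ⟫) ⟫
                            ⟪ ff b ⟦ B⁺ c ⟧ ∣ (λ M → ⟪ ff a ⟦ B⁺ M ⟧ ∣ ψ′ ⟫) ⟫
                            ⟪ ff b c ∣ (λ M → ⟪ ff a ⟦ B⁺ M ⟧ ∣ ψ′ ⟫) ⟫
                 ≈ rightAssociated ψ′ a ⟦ B⁺ b ⟧ ⟦ B⁺ c ⟧
      collapse = trans (sym (⟪tt-B⁺⟫ b c (λ S → ⟪ ff a ⟦ S ⟧ ∣ ψ′ ⟫)))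
                       (sym (⟪⟫-map ⟦_⟧ (tt (B⁺ b) (B⁺ c)) (λ M → ⟪ ff a M ∣ ψ′ ⟫)))

    tt-assoc-B⁺ : (∀ F G W → size³ F G W < size³ ⟦ B⁺ a ⟧ ⟦ B⁺ b ⟧ ⟦ B⁺ c ⟧ →
                            AssociativeAt ff F G W) →
                  AssociativeAt tt (B⁺ a) (B⁺ b) (B⁺ c)
    tt-assoc-B⁺ ff-assoc ψ =
      trans (expansionˡ ψ)
     (trans (expansion-cong (leftAssociated (ψ ∘ B⁺)) (rightAssociated (ψ ∘ B⁺))
                            (λ F G W smaller → ff-assoc F G W smaller (ψ ∘ B⁺)))
            (sym (expansionʳ ψ)))

  tt-assoc⇒ff-assoc : ∀ (g : Tree → Forest) → (∀ S S′ → tf S (g S′) ≡ mapL g (tt S S′)) →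
                      ∀ T T′ T″ → AssociativeAt tt T T′ T″ → AssociativeAt ff ⟦ T ⟧ ⟦ T′ ⟧ (g T″)
  tt-assoc⇒ff-assoc g tf-g T T′ T″ tt-assoc ψ = begin
    ⟪ ff ⟦ T ⟧ ⟦ T′ ⟧ ∣ (λ K → ⟪ ff K (g T″) ∣ ψ ⟫) ⟫
      ≈⟨ ⟪⟫-map ⟦_⟧ (tt T T′) _ ⟩
    ⟪ tt T T′ ∣ (λ S → ⟪ tf S (g T″) ∣ ψ ⟫) ⟫
      ≈⟨ ⟪⟫-congʳ (tt T T′) (λ S → tail S T″) ⟩
    ⟪ tt T T′ ∣ (λ S → ⟪ tt S T″ ∣ ψ ∘ g ⟫) ⟫
      ≈⟨ tt-assoc (ψ ∘ g) ⟩
    ⟪ tt T′ T″ ∣ (λ S → ⟪ tt T S ∣ ψ ∘ g ⟫) ⟫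
      ≈⟨ ⟪⟫-congʳ (tt T′ T″) (λ S → tail T S) ⟨
    ⟪ tt T′ T″ ∣ (λ S → ⟪ tf T (g S) ∣ ψ ⟫) ⟫
      ≈⟨ ⟪⟫-map g (tt T′ T″) _ ⟨
    ⟪ mapL g (tt T′ T″) ∣ (λ M → ⟪ ff ⟦ T ⟧ M ∣ ψ ⟫) ⟫
      ≈⟨ reflexive (≡.cong ⟪_∣ (λ M → ⟪ ff ⟦ T ⟧ M ∣ ψ ⟫) ⟫ (tf-g T′ T″)) ⟨
    ⟪ ff ⟦ T′ ⟧ (g T″) ∣ (λ M → ⟪ ff ⟦ T ⟧ M ∣ ψ ⟫) ⟫
      ∎
    where
    tail : ∀ S S′ → ⟪ tf S (g S′) ∣ ψ ⟫ ≈ ⟪ tt S S′ ∣ ψ ∘ g ⟫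
    tail S S′ = trans (reflexive (≡.cong ⟪_∣ ψ ⟫ (tf-g S S′))) (⟪⟫-map g (tt S S′) ψ)

  mutual
    tt-assoc-≤ : ∀ n T₁ T₂ T₃ → size³ ⟦ T₁ ⟧ ⟦ T₂ ⟧ ⟦ T₃ ⟧ ≤ n → AssociativeAt tt T₁ T₂ T₃
    tt-assoc-≤ _ • T₂ T₃ _ = AssociativeAt-identityˡ tt • (λ _ → ≡.refl) T₂ T₃
    tt-assoc-≤ _ T₁ • T₃ _ = AssociativeAt-identityᵐ tt • (λ _ → ≡.refl) tt-identityʳ T₁ T₃
    tt-assoc-≤ _ T₁ T₂ • _ = AssociativeAt-identityʳ tt • tt-identityʳ T₁ T₂
    tt-assoc-≤ (suc n) (B⁺ a) (B⁺ b) (B⁺ c) (s≤s size≤n) =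
      tt-assoc-B⁺ a b c λ F G W smaller →
        ff-assoc-≤ n F G W (ℕₚ.≤-trans (ℕₚ.<⇒≤pred smaller) size≤n)

    ff-assoc-≤ : ∀ n F G W → size³ F G W ≤ n → AssociativeAt ff F G W
    ff-assoc-≤ n (T ∷⟨ x ⟩ F) G W size≤n ψ = begin
      ⟪ ff (T ∷⟨ x ⟩ F) G ∣ (λ K → ⟪ ff K W ∣ ψ ⟫) ⟫
        ≈⟨ ⟪⟫-map (T ∷⟨ x ⟩_) (ff F G) _ ⟩
      ⟪ ff F G ∣ (λ K → ⟪ ff (T ∷⟨ x ⟩ K) W ∣ ψ ⟫) ⟫
        ≈⟨ ⟪⟫-congʳ (ff F G) (λ K → ⟪⟫-map (T ∷⟨ x ⟩_) (ff K W) ψ) ⟩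
      ⟪ ff F G ∣ (λ K → ⟪ ff K W ∣ ψ ∘ (T ∷⟨ x ⟩_) ⟫) ⟫
        ≈⟨ ff-assoc-≤ n F G W (ℕₚ.≤-trans (size³-∷₁ T x F G W) size≤n) (ψ ∘ (T ∷⟨ x ⟩_)) ⟩
      ⟪ ff G W ∣ (λ M → ⟪ ff F M ∣ ψ ∘ (T ∷⟨ x ⟩_) ⟫) ⟫
        ≈⟨ ⟪⟫-congʳ (ff G W) (λ M → ⟪⟫-map (T ∷⟨ x ⟩_) (ff F M) ψ) ⟨
      ⟪ ff G W ∣ (λ M → ⟪ ff (T ∷⟨ x ⟩ F) M ∣ ψ ⟫) ⟫
        ∎
    ff-assoc-≤ n ⟦ T ⟧ (T′ ∷⟨ y ⟩ G) W _ ψ = begin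
      ⟪ ff ⟦ T ⟧ (T′ ∷⟨ y ⟩ G) ∣ (λ K → ⟪ ff K W ∣ ψ ⟫) ⟫
        ≈⟨ ⟪⟫-map (_∷⟨ y ⟩ G) (tt T T′) _ ⟩
      ⟪ tt T T′ ∣ (λ S → ⟪ ff (S ∷⟨ y ⟩ G) W ∣ ψ ⟫) ⟫
        ≈⟨ ⟪⟫-congʳ (tt T T′) (λ S → ⟪⟫-map (S ∷⟨ y ⟩_) (ff G W) ψ) ⟩
      ⟪ tt T T′ ∣ (λ S → ⟪ ff G W ∣ (λ M → ψ (S ∷⟨ y ⟩ M)) ⟫) ⟫
        ≈⟨ ⟪⟫-swap (tt T T′) (ff G W) _ ⟩
      ⟪ ff G W ∣ (λ M → ⟪ tt T T′ ∣ (λ S → ψ (S ∷⟨ y ⟩ M)) ⟫) ⟫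
        ≈⟨ ⟪⟫-congʳ (ff G W) (λ M → ⟪⟫-map (_∷⟨ y ⟩ M) (tt T T′) ψ) ⟨
      ⟪ ff G W ∣ (λ M → ⟪ ff ⟦ T ⟧ (T′ ∷⟨ y ⟩ M) ∣ ψ ⟫) ⟫
        ≈⟨ ⟪⟫-map (T′ ∷⟨ y ⟩_) (ff G W) _ ⟨
      ⟪ ff (T′ ∷⟨ y ⟩ G) W ∣ (λ M → ⟪ ff ⟦ T ⟧ M ∣ ψ ⟫) ⟫
        ∎
    ff-assoc-≤ n ⟦ T ⟧ ⟦ T′ ⟧ (T″ ∷⟨ z ⟩ W) size≤n =
      tt-assoc⇒ff-assoc (_∷⟨ z ⟩ W) (λ _ _ → ≡.refl) T T′ T″
        (tt-assoc-≤ n T T′ T″ (ℕₚ.≤-trans (size³-∷₃ ⟦ T ⟧ ⟦ T′ ⟧ T″ z W) size≤n))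
    ff-assoc-≤ n ⟦ T ⟧ ⟦ T′ ⟧ ⟦ T″ ⟧ size≤n =
      tt-assoc⇒ff-assoc ⟦_⟧ (λ _ _ → ≡.refl) T T′ T″ (tt-assoc-≤ n T T′ T″ size≤n)

  ff-assoc : ∀ F G W → AssociativeAt ff F G W
  ff-assoc F G W = ff-assoc-≤ (size³ F G W) F G W ℕₚ.≤-refl

  ⋄-assoc : ∀ u v w → ((u ⋄ v) ⋄ w) ≋ (u ⋄ (v ⋄ w))
  ⋄-assoc u v w = ≐⇒≋ ((u ⋄ v) ⋄ w) (u ⋄ (v ⋄ w)) (⋆-assoc ff-assoc u v w)

  ⋄-identityˡ : ∀ u → (unit ⋄ u) ≋ u
  ⋄-identityˡ u = ≐⇒≋ (unit ⋄ u) u (⋆-identityˡ ⟦ • ⟧ ff-identityˡ u)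

  ⋄-identityʳ : ∀ u → (u ⋄ unit) ≋ u
  ⋄-identityʳ u = ≐⇒≋ (u ⋄ unit) u (⋆-identityʳ ⟦ • ⟧ ff-identityʳ u)

  module _ (ρ : U → U) where
    mutual
      tt-relT : ∀ T T′ → tt (relT ρ T) (relT ρ T′) ≡ mapL (relT ρ) (tt T T′)
      tt-relT •      _       = ≡.refl
      tt-relT (B⁺ _) •       = ≡.refl
      tt-relT (B⁺ A) (B⁺ A′) = ≡.trans relabel-summands (≡.sym distribute)
        where
        X = mapL B⁺ (tf (B⁺ A) A′)
        Y = mapL B⁺ (ft A (B⁺ A′))
        Z = scale λw (mapL B⁺ (ff A A′))

        relabel-summands : tt (relT ρ (B⁺ A)) (relT ρ (B⁺ A′))
                           ≡ mapL (relT ρ) X ++ mapL (relT ρ) Y ++ mapL (relT ρ) Z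
        relabel-summands =
          ≡.cong₂ _++_ (map-commute (λ _ → ≡.refl) (tf-relF (B⁺ A) A′))
            (≡.cong₂ _++_ (map-commute (λ _ → ≡.refl) (ft-relF A (B⁺ A′)))
                          (map-commute (λ _ → ≡.refl) (map-commute (λ _ → ≡.refl) (ff-relF A A′))))

        distribute : mapL (relT ρ) (X ++ Y ++ Z)
                     ≡ mapL (relT ρ) X ++ mapL (relT ρ) Y ++ mapL (relT ρ) Z
        distribute =
          ≡.trans (List.map-++ _ X (Y ++ Z)) (≡.cong (mapL (relT ρ) X ++_) (List.map-++ _ Y Z))

      tf-relF : ∀ T G → tf (relT ρ T) (relF ρ G) ≡ mapL (relF ρ) (tf T G)
      tf-relF T ⟦ T′ ⟧        = map-commute (λ _ → ≡.refl) (tt-relT T T′)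
      tf-relF T (T′ ∷⟨ y ⟩ G) = map-commute (λ _ → ≡.refl) (tt-relT T T′)

      ft-relF : ∀ F T′ → ft (relF ρ F) (relT ρ T′) ≡ mapL (relF ρ) (ft F T′)
      ft-relF ⟦ T ⟧        T′ = map-commute (λ _ → ≡.refl) (tt-relT T T′)
      ft-relF (T ∷⟨ x ⟩ F) T′ = map-commute (λ _ → ≡.refl) (ft-relF F T′)

      ff-relF : ∀ F G → ff (relF ρ F) (relF ρ G) ≡ mapL (relF ρ) (ff F G)
      ff-relF ⟦ T ⟧        G = tf-relF T G
      ff-relF (T ∷⟨ x ⟩ F) G = map-commute (λ _ → ≡.refl) (ff-relF F G)

    relabel-⋄ : ∀ u v → (relabel ρ u ⋄ relabel ρ v) ≡ relabel ρ (u ⋄ v)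
    relabel-⋄ = ⋆-map (relF ρ) ff-relF

  decF-∷ : ∀ T (x : U) F w K → decF K ≡ decF F ++ w → decF (T ∷⟨ x ⟩ K) ≡ decF (T ∷⟨ x ⟩ F) ++ w
  decF-∷ T x F w K eq =
    ≡.trans (≡.cong (λ l → decT T ++ x ∷ l) eq) (≡.sym (List.++-assoc (decT T) (x ∷ decF F) w))

  mutual
    decT-tt : ∀ T T′ → All (λ p → decT (proj₂ p) ≡ decT T ++ decT T′) (tt T T′)
    decT-tt •      _       = ≡.refl ∷ []
    decT-tt (B⁺ A) •       = ≡.sym (List.++-identityʳ (decF A)) ∷ []
    decT-tt (B⁺ A) (B⁺ A′) =
      All.++⁺ (All.map⁺ (decF-tf (B⁺ A) A′))
        (All.++⁺ (All.map⁺ (decF-ft A (B⁺ A′))) (All.map⁺ (All.map⁺ (decF-ff A A′))))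

    decF-tf : ∀ T G → All (λ p → decF (proj₂ p) ≡ decT T ++ decF G) (tf T G)
    decF-tf T ⟦ T′ ⟧        = All.map⁺ (decT-tt T T′)
    decF-tf T (T′ ∷⟨ y ⟩ G) =
      All.map⁺ (AllU.map (λ eq → ≡.trans (≡.cong (_++ y ∷ decF G) eq)
                                          (List.++-assoc (decT T) (decT T′) (y ∷ decF G)))
                         (decT-tt T T′))

    decF-ft : ∀ F T′ → All (λ p → decF (proj₂ p) ≡ decF F ++ decT T′) (ft F T′)
    decF-ft ⟦ T ⟧        T′ = All.map⁺ (decT-tt T T′)
    decF-ft (T ∷⟨ x ⟩ F) T′ =
      All.map⁺ (AllU.map (λ {(_ , K)} → decF-∷ T x F (decT T′) K) (decF-ft F T′))

    decF-ff : ∀ F G → All (λ p → decF (proj₂ p) ≡ decF F ++ decF G) (ff F G)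
    decF-ff ⟦ T ⟧        G = decF-tf T G
    decF-ff (T ∷⟨ x ⟩ F) G =
      All.map⁺ (AllU.map (λ {(_ , K)} → decF-∷ T x F (decF G) K) (decF-ff F G))

  ⋄-closed : ∀ {X Y u v} → u ∈ADF[ X ] → v ∈ADF[ Y ] → (u ⋄ v) ∈ADF[ X ++ Y ]
  ⋄-closed = ⋆-All λ {F} {G} F↭X G↭Y →
    AllU.map (λ eq → ≡.subst (_↭ _) (≡.sym eq) (Perm.++⁺ F↭X G↭Y)) (decF-ff F G)

  mutual
    decT-relT : ∀ (σ : U → U) T → decT (relT σ T) ≡ map σ (decT T)
    decT-relT σ •      = ≡.refl
    decT-relT σ (B⁺ F) = decF-relF σ F

    decF-relF : ∀ (σ : U → U) F → decF (relF σ F) ≡ map σ (decF F)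
    decF-relF σ ⟦ T ⟧        = decT-relT σ T
    decF-relF σ (T ∷⟨ x ⟩ F) =
      ≡.trans (≡.cong₂ (λ l r → l ++ σ x ∷ r) (decT-relT σ T) (decF-relF σ F))
              (≡.sym (List.map-++ σ (decT T) (x ∷ decF F)))

  relabel-closed : ∀ (σ : U → U) {X X′} → map σ X ↭ X′ → ∀ {u} → u ∈ADF[ X ] → relabel σ u ∈ADF[ X′ ]
  relabel-closed σ σX↭X′ = All.map⁺ ∘ AllU.map λ {(_ , F)} F↭X →
    ≡.subst (_↭ _) (≡.sym (decF-relF σ F)) (↭-trans (Perm.map⁺ σ F↭X) σX↭X′)

  mutual
    relT-cong : ∀ {σ ρ : U → U} T → (∀ {x} → x ∈ decT T → σ x ≡ ρ x) → relT σ T ≡ relT ρ T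
    relT-cong •      _     = ≡.refl
    relT-cong (B⁺ F) σ≗ρ = ≡.cong B⁺ (relF-cong F σ≗ρ)

    relF-cong : ∀ {σ ρ : U → U} F → (∀ {x} → x ∈ decF F → σ x ≡ ρ x) → relF σ F ≡ relF ρ F
    relF-cong ⟦ T ⟧        σ≗ρ = ≡.cong ⟦_⟧ (relT-cong T σ≗ρ)
    relF-cong (T ∷⟨ x ⟩ F) σ≗ρ
      rewrite relT-cong T (σ≗ρ ∘ ∈-++⁺ˡ)
            | σ≗ρ (∈-++⁺ʳ (decT T) (here ≡.refl))
            | relF-cong F (σ≗ρ ∘ ∈-++⁺ʳ (decT T) ∘ there) = ≡.refl

  relabel-cong : ∀ {σ ρ : U → U} {X u} → (∀ {x} → x ∈ X → σ x ≡ ρ x) → u ∈ADF[ X ] →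
                 relabel σ u ≡ relabel ρ u
  relabel-cong σ≗ρ []                  = ≡.refl
  relabel-cong σ≗ρ (_∷_ {a , F} F↭X u∈X) =
    ≡.cong₂ _∷_ (≡.cong (a ,_) (relF-cong F (σ≗ρ ∘ Perm.∈-resp-↭ F↭X))) (relabel-cong σ≗ρ u∈X)

  ⋄-natural : ∀ (σ τ ρ : U → U) {X Y} →
              (∀ {x} → x ∈ X → ρ x ≡ σ x) → (∀ {y} → y ∈ Y → ρ y ≡ τ y) →
              ∀ {u v} → u ∈ADF[ X ] → v ∈ADF[ Y ] → (relabel σ u ⋄ relabel τ v) ≋ relabel ρ (u ⋄ v)
  ⋄-natural σ τ ρ ρ≗σ ρ≗τ {u} {v} u∈X v∈Y F = reflexive (≡.cong (coeff F) (≡.trans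
    (≡.cong₂ _⋄_ (relabel-cong (≡.sym ∘ ρ≗σ) u∈X) (relabel-cong (≡.sym ∘ ρ≗τ) v∈Y))
    (relabel-⋄ ρ u v)))

proposition2p14 : ∀ {c ℓ} (k : Field c ℓ) → CharacteristicZero k →
    (λw : Field.Carrier k) (U : Set) (_≟_ : DecidableEquality U) →
    let open ADF k λw U _≟_ in
    IsTwistedAlgebra U _≋_ _∈ADF[_] relabel _⋄_ unit
proposition2p14 k _ λw U _≟_ = record
  { P-closed = λ σ _ _ → relabel-closed σ
  ; m-closed = λ _ _ _ → ⋄-closed
  ; m-cong   = λ {u} {u′} {v} {v′} → ⋄-cong {u} {u′} {v} {v′}
  ; natural  = λ σ τ ρ _ _ _ _ _ _ _ _ → ⋄-natural σ τ ρ
  ; assoc    = λ _ _ _ _ _ _ {u} {v} {w} _ _ _ → ⋄-assoc u v w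
  ; unit-in  = ↭-refl ∷ []
  ; unitˡ    = λ _ {u} _ → ⋄-identityˡ u
  ; unitʳ    = λ _ {u} _ → ⋄-identityʳ u
  }
  where open ADFProperties k λw U _≟_
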